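{- For all integers $n$, $r$ and $k$ with $n\ge r-1\ge 0$, $$\sum_{j=r-1}^n\left\{{n+1\atop j+1}\right\}_r\widehat c_j^{(k)}=\sum_{\ell=1}^{r}(-1)^{r-\ell}\left[{r\atop \ell}\right]\sum_{i=0}^{n-r+\ell}\binom{n-r+\ell}{i}\frac{(-1)^i}{(i+1)^k}.$$
   Context: For an integer $k$, the poly-Cauchy numbers of the second kind $\widehat c_n^{(k)}$ are defined by $\mathrm{Lif}_k(-\log(1+x))=\sum_{n\ge0}\widehat c_n^{(k)}x^n/n!$, where $\mathrm{Lif}_k(z)=\sum_{m\ge0}\frac{z^m}{m!(m+1)^k}$. $\left[{n\atop m}\right]$ denotes the unsigned Stirling number of the first kind, defined by $x(x+1)\cdots(x+n-1)=\sum_{m}\left[{n\atop m}\right]x^m$. For $r\ge 0$, the $r$-Stirling number of the second kind $\left\{{n\atop m}\right\}_r$ is the number of ways to partition $\{1,\dots,n\}$ into $m$ nonempty disjoint blocks such that $1,\dots,r$ lie in distinct blocks; equivalently $\left\{{n\atop m}\right\}_r=0$ for $n<r$, $\left\{{r\atop m}\right\}_r=\delta_{m,r}$, and $\left\{{n\atop m}\right\}_r=m\left\{{n-1\atop m}\right\}_r+\left\{{n-1\atop m-1}\right\}_r$ for $n>r$. -}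

module Defs where

open import Data.Nat as ℕ using (ℕ; zero; suc; _∸_)
open import Data.Integer as ℤ using (ℤ; +_; -[1+_])
open import Data.Rational using (ℚ; _+_; _*_; -_; _/_; 0ℚ; 1ℚ)
open import Data.Bool using (if_then_else_; _∧_)
open import Data.List using (List; map; foldr; upTo)

Σ≤ : ℕ → (ℕ → ℚ) → ℚ
Σ≤ n f = foldr _+_ 0ℚ (map f (upTo (suc n)))

-- Σ_{i=lo}^{hi} f i  (empty if hi < lo)
Σ[_⋯_] : ℕ → ℕ → (ℕ → ℚ) → ℚ
Σ[ lo ⋯ hi ] f = foldr _+_ 0ℚ (map (λ i → f (lo ℕ.+ i)) (upTo (suc hi ∸ lo)))

ℕ→ℚ : ℕ → ℚ
ℕ→ℚ n = (+ n) / 1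

ℤ→ℚ : ℤ → ℚ
ℤ→ℚ z = z / 1

_^ℚ_ : ℚ → ℕ → ℚ
q ^ℚ zero = 1ℚ
q ^ℚ suc n = q * (q ^ℚ n)

sgn : ℕ → ℚ
sgn n = (- 1ℚ) ^ℚ n

factℚ : ℕ → ℚ
factℚ zero = 1ℚ
factℚ (suc n) = ℕ→ℚ (suc n) * factℚ n

invFact : ℕ → ℚ
invFact zero = 1ℚ
invFact (suc n) = ((+ 1) / suc n) * invFact n

invPowSuc : ℕ → ℤ → ℚ
invPowSuc m (+ n) = ((+ 1) / suc m) ^ℚ n
invPowSuc m -[1+ n ] = ℕ→ℚ (suc m) ^ℚ suc n

Series : Set
Series = ℕ → ℚ

_⊛_ : Series → Series → Series
(f ⊛ g) n = Σ≤ n (λ i → f i * g (n ∸ i))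

one : Series
one zero = 1ℚ
one (suc n) = 0ℚ

_^S_ : Series → ℕ → Series
f ^S zero = one
f ^S suc m = f ⊛ (f ^S m)

negLog1p : Series
negLog1p zero = 0ℚ
negLog1p (suc i) = sgn (suc i) * ((+ 1) / suc i)

-- Poly-Cauchy numbers of the second kind:
-- ĉ_n^{(k)} = n! · [x^n] Lif_k(-log(1+x)),
-- Lif_k(z) = Σ_m z^m / (m! (m+1)^k).  Since (-log(1+x))^m has order m,
-- only m ≤ n contribute to [x^n].
polyCauchy2 : ℤ → ℕ → ℚ
polyCauchy2 k n =
  factℚ n * Σ≤ n (λ m → invFact m * invPowSuc m k * (negLog1p ^S m) n)

-- Unsigned Stirling numbers of the first kind:
-- stirling1 n m = [x^m] x(x+1)...(x+n-1), computed by multiplying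
-- the coefficient list of x(x+1)...(x+n-1) by (x+n).
stirling1 : ℕ → ℕ → ℕ
stirling1 zero zero = 1
stirling1 zero (suc m) = 0
stirling1 (suc n) zero = n ℕ.* stirling1 n zero
stirling1 (suc n) (suc m) = stirling1 n m ℕ.+ n ℕ.* stirling1 n (suc m)

rStirling2 : ℕ → ℕ → ℕ → ℕ
rStirling2 r zero m = if (r ℕ.≡ᵇ 0) ∧ (m ℕ.≡ᵇ 0) then 1 else 0
rStirling2 r (suc n) m =
  if suc n ℕ.<ᵇ r then 0
  else if suc n ℕ.≡ᵇ r then (if m ℕ.≡ᵇ r then 1 else 0)
  else m ℕ.* rStirling2 r n m ℕ.+ lower m
  where
  lower : ℕ → ℕ
  lower zero = 0
  lower (suc m′) = rStirling2 r n m′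

choose : ℕ → ℕ → ℕ
choose n zero = 1
choose zero (suc k) = 0
choose (suc n) (suc k) = choose n k ℕ.+ choose n (suc k)

-- Write a_m = 1/(m+1)^k.  Since (1+x) · ((-log(1+x))^(m+1))′ = -(m+1) (-log(1+x))^m,
-- the coefficients of (-log(1+x))^m are signed Stirling numbers of the first kind, and
-- ĉ_j = (-1)^j Σ_m [j m] a_m.  Put r = r′ + 1 and n = r′ + p.  The recurrence
-- {N+1, j+1}_r = (j+1) {N, j+1}_r + {N, j}_r turns the left-hand side into (Θ^p ĉ)_r′ where
-- (Θ b)_j = (j+1) b_j + b_(j+1), and on sequences of the form (-1)^j Σ_m [j m] a_m the
-- operator Θ acts as the difference (∇ a)_m = a_m - a_(m+1).  So the left-hand side is
-- (-1)^r′ Σ_m [r′ m] (∇^p a)_m, i.e. the rising factorial x(x+1)⋯(x+r′-1) evaluated at the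
-- shift x = 1 - ∇; expanding it in powers of ∇ gives (∇-1)(∇-2)⋯(∇-r′), whose coefficients
-- are the signed numbers (-1)^(r-ℓ) [r ℓ], and ∇^q a at 0 is the alternating binomial sum.

module Submission where

open import Data.Bool using (true; false; T)
open import Data.Unit using (tt)
open import Data.Integer as ℤ using (ℤ; +_)
import Data.Integer.Properties as ℤₚ
open import Data.List using (map; foldr; applyUpTo)
open import Data.Nat as ℕ using (ℕ; zero; suc; _∸_; _<_; _≤_; _<?_; _≟_; z≤n; s≤s)
import Data.Nat.Properties as ℕₚ
open import Data.Rational using (ℚ; _+_; _*_; -_; _/_; 0ℚ; 1ℚ; toℚᵘ)
open import Data.Rational.Properties
  using ( toℚᵘ-injective; toℚᵘ-fromℚᵘ; toℚᵘ-homo-+; toℚᵘ-homo-*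
        ; +-identityˡ; +-identityʳ; +-assoc; *-identityˡ; *-identityʳ; *-zeroˡ; *-zeroʳ; *-assoc
        ; *-distribˡ-+; *-distribʳ-+; neg-distrib-+; neg-distribˡ-*; neg-distribʳ-* )
import Data.Rational.Unnormalised as ℚᵘ
import Data.Rational.Unnormalised.Properties as ℚᵘₚ
open import Data.Rational.Solver using (module +-*-Solver)
open import Function using (_∘_)
open import Function.Endo.Propositional (ℕ → ℚ) using (_^_; ^-homo)
open import Relation.Binary.PropositionalEquality
open import Relation.Nullary.Decidable using (dec-true; dec-false)
open import Defs
open +-*-Solver

-- `_/_` computes as `fromℚᵘ` of the unnormalised fraction, so identities in ℚ are
-- checked through `toℚᵘ`.
toℚᵘ-ℕ→ℚ : ∀ n → toℚᵘ (ℕ→ℚ n) ℚᵘ.≃ ℚᵘ.mkℚᵘ (+ n) 0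
toℚᵘ-ℕ→ℚ n = toℚᵘ-fromℚᵘ (ℚᵘ.mkℚᵘ (+ n) 0)

ℕ→ℚ-+ : ∀ a b → ℕ→ℚ (a ℕ.+ b) ≡ ℕ→ℚ a + ℕ→ℚ b
ℕ→ℚ-+ a b = toℚᵘ-injective (begin
  toℚᵘ (ℕ→ℚ (a ℕ.+ b))                 ≈⟨ toℚᵘ-ℕ→ℚ (a ℕ.+ b) ⟩
  ℚᵘ.mkℚᵘ (+ (a ℕ.+ b)) 0              ≈⟨ ℚᵘ.*≡* (cong (ℤ._* + 1) pos-+) ⟩
  ℚᵘ.mkℚᵘ (+ a) 0 ℚᵘ.+ ℚᵘ.mkℚᵘ (+ b) 0 ≈⟨ ℚᵘₚ.+-cong (toℚᵘ-ℕ→ℚ a) (toℚᵘ-ℕ→ℚ b) ⟨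
  toℚᵘ (ℕ→ℚ a) ℚᵘ.+ toℚᵘ (ℕ→ℚ b)       ≈⟨ toℚᵘ-homo-+ (ℕ→ℚ a) (ℕ→ℚ b) ⟨
  toℚᵘ (ℕ→ℚ a + ℕ→ℚ b)                 ∎)
  where
  open ℚᵘₚ.≃-Reasoning
  pos-+ : + (a ℕ.+ b) ≡ + a ℤ.* + 1 ℤ.+ + b ℤ.* + 1
  pos-+ = trans (ℤₚ.pos-+ a b) (sym (cong₂ ℤ._+_ (ℤₚ.*-identityʳ (+ a)) (ℤₚ.*-identityʳ (+ b))))

ℕ→ℚ-* : ∀ a b → ℕ→ℚ (a ℕ.* b) ≡ ℕ→ℚ a * ℕ→ℚ b
ℕ→ℚ-* a b = toℚᵘ-injective (begin
  toℚᵘ (ℕ→ℚ (a ℕ.* b))                 ≈⟨ toℚᵘ-ℕ→ℚ (a ℕ.* b) ⟩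
  ℚᵘ.mkℚᵘ (+ (a ℕ.* b)) 0              ≈⟨ ℚᵘ.*≡* (cong (ℤ._* + 1) (ℤₚ.pos-* a b)) ⟩
  ℚᵘ.mkℚᵘ (+ a) 0 ℚᵘ.* ℚᵘ.mkℚᵘ (+ b) 0 ≈⟨ ℚᵘₚ.*-cong (toℚᵘ-ℕ→ℚ a) (toℚᵘ-ℕ→ℚ b) ⟨
  toℚᵘ (ℕ→ℚ a) ℚᵘ.* toℚᵘ (ℕ→ℚ b)       ≈⟨ toℚᵘ-homo-* (ℕ→ℚ a) (ℕ→ℚ b) ⟨
  toℚᵘ (ℕ→ℚ a * ℕ→ℚ b)                 ∎)
  where open ℚᵘₚ.≃-Reasoning

ℕ→ℚ-suc : ∀ n → ℕ→ℚ (suc n) ≡ 1ℚ + ℕ→ℚ n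
ℕ→ℚ-suc = ℕ→ℚ-+ 1

1/suc-inverseˡ : ∀ m → ((+ 1) / suc m) * ℕ→ℚ (suc m) ≡ 1ℚ
1/suc-inverseˡ m = toℚᵘ-injective (begin
  toℚᵘ ((+ 1) / suc m * ℕ→ℚ (suc m))                    ≈⟨ toℚᵘ-homo-* ((+ 1) / suc m) (ℕ→ℚ (suc m)) ⟩
  toℚᵘ ((+ 1) / suc m) ℚᵘ.* toℚᵘ (ℕ→ℚ (suc m))          ≈⟨ ℚᵘₚ.*-cong (toℚᵘ-fromℚᵘ (ℚᵘ.mkℚᵘ (+ 1) m)) (toℚᵘ-ℕ→ℚ (suc m)) ⟩
  ℚᵘ.mkℚᵘ (+ 1) m ℚᵘ.* ℚᵘ.mkℚᵘ (+ suc m) 0              ≈⟨ ℚᵘ.*≡* (cong (λ x → + suc x) m+0*1≡m*1+0) ⟩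
  ℚᵘ.1ℚᵘ                                                 ∎)
  where
  open ℚᵘₚ.≃-Reasoning
  m+0*1≡m*1+0 : (m ℕ.+ 0) ℕ.* 1 ≡ m ℕ.* 1 ℕ.+ 0
  m+0*1≡m*1+0 = trans (ℕₚ.*-identityʳ (m ℕ.+ 0)) (cong (ℕ._+ 0) (sym (ℕₚ.*-identityʳ m)))

-- Finite sums

∑< : ℕ → (ℕ → ℚ) → ℚ
∑< zero    f = 0ℚ
∑< (suc n) f = f 0 + ∑< n (f ∘ suc)

syntax ∑< n (λ i → e) = ∑[ i < n ] e

foldr-map-applyUpTo : ∀ n (f : ℕ → ℚ) (g : ℕ → ℕ) →
  foldr _+_ 0ℚ (map f (applyUpTo g n)) ≡ ∑[ i < n ] f (g i)
foldr-map-applyUpTo zero    f g = refl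
foldr-map-applyUpTo (suc n) f g = cong (_+_ (f (g 0))) (foldr-map-applyUpTo n f (g ∘ suc))

Σ≤≡∑< : ∀ n f → Σ≤ n f ≡ ∑< (suc n) f
Σ≤≡∑< n f = foldr-map-applyUpTo (suc n) f (λ i → i)

Σ[⋯]≡∑< : ∀ lo hi f → Σ[ lo ⋯ hi ] f ≡ ∑[ i < suc hi ∸ lo ] f (lo ℕ.+ i)
Σ[⋯]≡∑< lo hi f = foldr-map-applyUpTo (suc hi ∸ lo) (λ i → f (lo ℕ.+ i)) (λ i → i)

∑<-congᵇ : ∀ n {f g : ℕ → ℚ} → (∀ i → i < n → f i ≡ g i) → ∑< n f ≡ ∑< n g
∑<-congᵇ zero    f≡g = refl
∑<-congᵇ (suc n) f≡g = cong₂ _+_ (f≡g 0 (s≤s z≤n)) (∑<-congᵇ n (λ i i<n → f≡g (suc i) (s≤s i<n)))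

∑<-cong : ∀ n {f g : ℕ → ℚ} → (∀ i → f i ≡ g i) → ∑< n f ≡ ∑< n g
∑<-cong n f≡g = ∑<-congᵇ n (λ i _ → f≡g i)

∑<-zero : ∀ n {f : ℕ → ℚ} → (∀ i → i < n → f i ≡ 0ℚ) → ∑< n f ≡ 0ℚ
∑<-zero zero    f≡0 = refl
∑<-zero (suc n) f≡0 = trans (cong₂ _+_ (f≡0 0 (s≤s z≤n)) (∑<-zero n (λ i i<n → f≡0 (suc i) (s≤s i<n))))
                            (+-identityʳ 0ℚ)

∑<-+ : ∀ n (f g : ℕ → ℚ) → ∑[ i < n ] (f i + g i) ≡ ∑< n f + ∑< n g
∑<-+ zero    f g = sym (+-identityʳ 0ℚ)
∑<-+ (suc n) f g = trans (cong (_+_ (f 0 + g 0)) (∑<-+ n (f ∘ suc) (g ∘ suc)))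
                         (solve 4 (λ a b c d → (a :+ b) :+ (c :+ d) := (a :+ c) :+ (b :+ d)) refl
                                (f 0) (g 0) (∑< n (f ∘ suc)) (∑< n (g ∘ suc)))

∑<-*ˡ : ∀ n c (f : ℕ → ℚ) → ∑[ i < n ] (c * f i) ≡ c * ∑< n f
∑<-*ˡ zero    c f = sym (*-zeroʳ c)
∑<-*ˡ (suc n) c f = trans (cong (_+_ (c * f 0)) (∑<-*ˡ n c (f ∘ suc))) (sym (*-distribˡ-+ c (f 0) _))

∑<-neg : ∀ n (f : ℕ → ℚ) → ∑[ i < n ] (- f i) ≡ - ∑< n f
∑<-neg zero    f = refl
∑<-neg (suc n) f = trans (cong (_+_ (- f 0)) (∑<-neg n (f ∘ suc))) (sym (neg-distrib-+ (f 0) _))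

∑<-*-− : ∀ n (w x y : ℕ → ℚ) →
  ∑[ i < n ] (w i * (x i + - y i)) ≡ ∑[ i < n ] (w i * x i) + - ∑[ i < n ] (w i * y i)
∑<-*-− n w x y = begin
  ∑[ i < n ] (w i * (x i + - y i))              ≡⟨ ∑<-cong n distrib ⟩
  ∑[ i < n ] (w i * x i + - (w i * y i))        ≡⟨ ∑<-+ n (λ i → w i * x i) (λ i → - (w i * y i)) ⟩
  ∑[ i < n ] (w i * x i) + ∑[ i < n ] (- (w i * y i)) ≡⟨ cong (_+_ (∑[ i < n ] (w i * x i))) (∑<-neg n (λ i → w i * y i)) ⟩
  ∑[ i < n ] (w i * x i) + - ∑[ i < n ] (w i * y i) ∎
  where
  open ≡-Reasoning
  distrib : ∀ i → w i * (x i + - y i) ≡ w i * x i + - (w i * y i)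
  distrib i = trans (*-distribˡ-+ (w i) (x i) (- y i)) (cong (_+_ (w i * x i)) (sym (neg-distribʳ-* (w i) (y i))))

∑<-+-length : ∀ m n (f : ℕ → ℚ) → ∑< (m ℕ.+ n) f ≡ ∑< m f + ∑[ i < n ] f (m ℕ.+ i)
∑<-+-length zero    n f = sym (+-identityˡ _)
∑<-+-length (suc m) n f = trans (cong (_+_ (f 0)) (∑<-+-length m n (f ∘ suc))) (sym (+-assoc (f 0) _ _))

∑<-sucʳ : ∀ n (f : ℕ → ℚ) → ∑< (suc n) f ≡ ∑< n f + f n
∑<-sucʳ zero    f = trans (+-identityʳ (f 0)) (sym (+-identityˡ (f 0)))
∑<-sucʳ (suc n) f = trans (cong (_+_ (f 0)) (∑<-sucʳ n (f ∘ suc))) (sym (+-assoc (f 0) _ _))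

∑<-dropLast : ∀ n {f : ℕ → ℚ} → f n ≡ 0ℚ → ∑< (suc n) f ≡ ∑< n f
∑<-dropLast n {f} fn≡0 = trans (∑<-sucʳ n f) (trans (cong (_+_ (∑< n f)) fn≡0) (+-identityʳ _))

∑<-dropFirst : ∀ n {f : ℕ → ℚ} → f 0 ≡ 0ℚ → ∑< (suc n) f ≡ ∑< n (f ∘ suc)
∑<-dropFirst n {f} f0≡0 = trans (cong (_+ ∑< n (f ∘ suc)) f0≡0) (+-identityˡ _)

Σ[⋯]≡∑<-vanishing-below : ∀ lo hi {f : ℕ → ℚ} → lo ≤ suc hi → (∀ j → j < lo → f j ≡ 0ℚ) →
  Σ[ lo ⋯ hi ] f ≡ ∑< (suc hi) f
Σ[⋯]≡∑<-vanishing-below lo hi {f} lo≤1+hi f≡0 = begin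
  Σ[ lo ⋯ hi ] f                                   ≡⟨ Σ[⋯]≡∑< lo hi f ⟩
  ∑[ i < suc hi ∸ lo ] f (lo ℕ.+ i)                ≡⟨ +-identityˡ _ ⟨
  0ℚ + ∑[ i < suc hi ∸ lo ] f (lo ℕ.+ i)           ≡⟨ cong (_+ ∑[ i < suc hi ∸ lo ] f (lo ℕ.+ i)) (∑<-zero lo f≡0) ⟨
  ∑< lo f + ∑[ i < suc hi ∸ lo ] f (lo ℕ.+ i)      ≡⟨ ∑<-+-length lo (suc hi ∸ lo) f ⟨
  ∑< (lo ℕ.+ (suc hi ∸ lo)) f                      ≡⟨ cong (λ n → ∑< n f) (ℕₚ.m+[n∸m]≡n lo≤1+hi) ⟩
  ∑< (suc hi) f                                    ∎
  where open ≡-Reasoning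

-- Formal power series

∂ : Series → Series
∂ f n = ℕ→ℚ (suc n) * f (suc n)

[1+x]*_ : Series → Series
([1+x]* f) zero    = f 0
([1+x]* f) (suc n) = f (suc n) + f n

⊛≡∑< : ∀ f g n → (f ⊛ g) n ≡ ∑[ i < suc n ] (f i * g (n ∸ i))
⊛≡∑< f g n = Σ≤≡∑< n (λ i → f i * g (n ∸ i))

⊛-congˡ : ∀ {f f′} g → (∀ i → f i ≡ f′ i) → ∀ n → (f ⊛ g) n ≡ (f′ ⊛ g) n
⊛-congˡ {f} {f′} g f≡f′ n = begin
  (f ⊛ g) n                           ≡⟨ ⊛≡∑< f g n ⟩
  ∑[ i < suc n ] (f i * g (n ∸ i))    ≡⟨ ∑<-cong (suc n) (λ i → cong (_* g (n ∸ i)) (f≡f′ i)) ⟩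
  ∑[ i < suc n ] (f′ i * g (n ∸ i))   ≡⟨ ⊛≡∑< f′ g n ⟨
  (f′ ⊛ g) n                          ∎
  where open ≡-Reasoning

⊛-congʳ : ∀ f {g g′} → (∀ i → g i ≡ g′ i) → ∀ n → (f ⊛ g) n ≡ (f ⊛ g′) n
⊛-congʳ f {g} {g′} g≡g′ n = begin
  (f ⊛ g) n                           ≡⟨ ⊛≡∑< f g n ⟩
  ∑[ i < suc n ] (f i * g (n ∸ i))    ≡⟨ ∑<-cong (suc n) (λ i → cong (f i *_) (g≡g′ (n ∸ i))) ⟩
  ∑[ i < suc n ] (f i * g′ (n ∸ i))   ≡⟨ ⊛≡∑< f g′ n ⟨
  (f ⊛ g′) n                          ∎
  where open ≡-Reasoning

one-⊛ : ∀ g n → (one ⊛ g) n ≡ g n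
one-⊛ g n = begin
  (one ⊛ g) n                                          ≡⟨ ⊛≡∑< one g n ⟩
  1ℚ * g n + ∑[ i < n ] (0ℚ * g (n ∸ suc i))           ≡⟨ cong₂ _+_ (*-identityˡ (g n)) (∑<-zero n (λ i _ → *-zeroˡ (g (n ∸ suc i)))) ⟩
  g n + 0ℚ                                             ≡⟨ +-identityʳ (g n) ⟩
  g n                                                  ∎
  where open ≡-Reasoning

⊛-zeroʳ : ∀ f {g} → (∀ i → g i ≡ 0ℚ) → ∀ n → (f ⊛ g) n ≡ 0ℚ
⊛-zeroʳ f {g} g≡0 n =
  trans (⊛≡∑< f g n) (∑<-zero (suc n) (λ i _ → trans (cong (f i *_) (g≡0 (n ∸ i))) (*-zeroʳ (f i))))

⊛-*ʳ : ∀ c f g n → (f ⊛ (λ i → c * g i)) n ≡ c * (f ⊛ g) n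
⊛-*ʳ c f g n = begin
  (f ⊛ (λ i → c * g i)) n                   ≡⟨ ⊛≡∑< f (λ i → c * g i) n ⟩
  ∑[ i < suc n ] (f i * (c * g (n ∸ i)))    ≡⟨ ∑<-cong (suc n) (λ i → swap (f i) c (g (n ∸ i))) ⟩
  ∑[ i < suc n ] (c * (f i * g (n ∸ i)))    ≡⟨ ∑<-*ˡ (suc n) c (λ i → f i * g (n ∸ i)) ⟩
  c * ∑[ i < suc n ] (f i * g (n ∸ i))      ≡⟨ cong (c *_) (⊛≡∑< f g n) ⟨
  c * (f ⊛ g) n                             ∎
  where
  open ≡-Reasoning
  swap : ∀ x c y → x * (c * y) ≡ c * (x * y)
  swap = solve 3 (λ x c y → x :* (c :* y) := c :* (x :* y)) refl

⊛-negˡ : ∀ f g n → ((λ i → - f i) ⊛ g) n ≡ - (f ⊛ g) n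
⊛-negˡ f g n = begin
  ((λ i → - f i) ⊛ g) n                     ≡⟨ ⊛≡∑< (λ i → - f i) g n ⟩
  ∑[ i < suc n ] (- f i * g (n ∸ i))        ≡⟨ ∑<-cong (suc n) (λ i → neg-distribˡ-* (f i) (g (n ∸ i))) ⟨
  ∑[ i < suc n ] (- (f i * g (n ∸ i)))      ≡⟨ ∑<-neg (suc n) (λ i → f i * g (n ∸ i)) ⟩
  - ∑[ i < suc n ] (f i * g (n ∸ i))        ≡⟨ cong -_ (⊛≡∑< f g n) ⟨
  - (f ⊛ g) n                               ∎
  where open ≡-Reasoning

[1+x]*-cong : ∀ {f g} → (∀ i → f i ≡ g i) → ∀ n → ([1+x]* f) n ≡ ([1+x]* g) n
[1+x]*-cong f≡g zero    = f≡g 0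
[1+x]*-cong f≡g (suc n) = cong₂ _+_ (f≡g (suc n)) (f≡g n)

[1+x]*-+ : ∀ f g n → ([1+x]* (λ i → f i + g i)) n ≡ ([1+x]* f) n + ([1+x]* g) n
[1+x]*-+ f g zero    = refl
[1+x]*-+ f g (suc n) =
  solve 4 (λ a b c d → (a :+ b) :+ (c :+ d) := (a :+ c) :+ (b :+ d)) refl (f (suc n)) (g (suc n)) (f n) (g n)

[1+x]*-⊛ˡ : ∀ f g n → ([1+x]* (f ⊛ g)) n ≡ (([1+x]* f) ⊛ g) n
[1+x]*-⊛ˡ f g zero    = refl
[1+x]*-⊛ˡ f g (suc n) = begin
  (f ⊛ g) (suc n) + (f ⊛ g) n
    ≡⟨ cong₂ _+_ (⊛≡∑< f g (suc n)) (⊛≡∑< f g n) ⟩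
  (f 0 * g (suc n) + ∑[ i < suc n ] (f (suc i) * g (n ∸ i))) + ∑[ i < suc n ] (f i * g (n ∸ i))
    ≡⟨ +-assoc (f 0 * g (suc n)) _ _ ⟩
  f 0 * g (suc n) + (∑[ i < suc n ] (f (suc i) * g (n ∸ i)) + ∑[ i < suc n ] (f i * g (n ∸ i)))
    ≡⟨ cong (_+_ (f 0 * g (suc n))) (∑<-+ (suc n) (λ i → f (suc i) * g (n ∸ i)) (λ i → f i * g (n ∸ i))) ⟨
  f 0 * g (suc n) + ∑[ i < suc n ] (f (suc i) * g (n ∸ i) + f i * g (n ∸ i))
    ≡⟨ cong (_+_ (f 0 * g (suc n))) (∑<-cong (suc n) (λ i → *-distribʳ-+ (g (n ∸ i)) (f (suc i)) (f i))) ⟨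
  ∑[ i < suc (suc n) ] (([1+x]* f) i * g (suc n ∸ i))
    ≡⟨ ⊛≡∑< ([1+x]* f) g (suc n) ⟨
  (([1+x]* f) ⊛ g) (suc n) ∎
  where open ≡-Reasoning

[1+x]*-⊛ʳ : ∀ f g n → ([1+x]* (f ⊛ g)) n ≡ (f ⊛ ([1+x]* g)) n
[1+x]*-⊛ʳ f g zero    = refl
[1+x]*-⊛ʳ f g (suc n) = begin
  (f ⊛ g) (suc n) + (f ⊛ g) n
    ≡⟨ cong₂ _+_ (trans (⊛≡∑< f g (suc n)) (∑<-sucʳ (suc n) (λ i → f i * g (suc n ∸ i)))) (⊛≡∑< f g n) ⟩
  (∑[ i < suc n ] (f i * g (suc n ∸ i)) + f (suc n) * g (n ∸ n)) + ∑[ i < suc n ] (f i * g (n ∸ i))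
    ≡⟨ solve 3 (λ a b c → (a :+ b) :+ c := (a :+ c) :+ b) refl
               (∑[ i < suc n ] (f i * g (suc n ∸ i))) (f (suc n) * g (n ∸ n)) (∑[ i < suc n ] (f i * g (n ∸ i))) ⟩
  (∑[ i < suc n ] (f i * g (suc n ∸ i)) + ∑[ i < suc n ] (f i * g (n ∸ i))) + f (suc n) * g (n ∸ n)
    ≡⟨ cong₂ _+_ (sym (∑<-+ (suc n) (λ i → f i * g (suc n ∸ i)) (λ i → f i * g (n ∸ i))))
                 (cong (λ m → f (suc n) * g m) (ℕₚ.n∸n≡0 n)) ⟩
  ∑[ i < suc n ] (f i * g (suc n ∸ i) + f i * g (n ∸ i)) + f (suc n) * g 0
    ≡⟨ cong₂ _+_ (∑<-congᵇ (suc n) factor) (cong (λ m → f (suc n) * ([1+x]* g) m) (sym (ℕₚ.n∸n≡0 n))) ⟩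
  ∑[ i < suc n ] (f i * ([1+x]* g) (suc n ∸ i)) + f (suc n) * ([1+x]* g) (suc n ∸ suc n)
    ≡⟨ trans (⊛≡∑< f ([1+x]* g) (suc n)) (∑<-sucʳ (suc n) (λ i → f i * ([1+x]* g) (suc n ∸ i))) ⟨
  (f ⊛ ([1+x]* g)) (suc n) ∎
  where
  open ≡-Reasoning
  factor : ∀ i → i < suc n → f i * g (suc n ∸ i) + f i * g (n ∸ i) ≡ f i * ([1+x]* g) (suc n ∸ i)
  factor i (s≤s i≤n) rewrite ℕₚ.+-∸-assoc 1 i≤n = sym (*-distribˡ-+ (f i) _ _)

∂-⊛ : ∀ f g n → ∂ (f ⊛ g) n ≡ (∂ f ⊛ g) n + (f ⊛ ∂ g) n
∂-⊛ f g n = begin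
  ℕ→ℚ (suc n) * (f ⊛ g) (suc n)                                  ≡⟨ cong (ℕ→ℚ (suc n) *_) (⊛≡∑< f g (suc n)) ⟩
  ℕ→ℚ (suc n) * ∑[ i < suc (suc n) ] t i                         ≡⟨ ∑<-*ˡ (suc (suc n)) (ℕ→ℚ (suc n)) t ⟨
  ∑[ i < suc (suc n) ] (ℕ→ℚ (suc n) * t i)                       ≡⟨ ∑<-congᵇ (suc (suc n)) split ⟩
  ∑[ i < suc (suc n) ] (ℕ→ℚ i * t i + ℕ→ℚ (suc n ∸ i) * t i)     ≡⟨ ∑<-+ (suc (suc n)) (λ i → ℕ→ℚ i * t i) (λ i → ℕ→ℚ (suc n ∸ i) * t i) ⟩
  ∑[ i < suc (suc n) ] (ℕ→ℚ i * t i) + ∑[ i < suc (suc n) ] (ℕ→ℚ (suc n ∸ i) * t i)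
                                                                 ≡⟨ cong₂ _+_ (∑<-dropFirst (suc n) {λ i → ℕ→ℚ i * t i} (*-zeroˡ (t 0)))
                                                                              (∑<-dropLast (suc n) {λ i → ℕ→ℚ (suc n ∸ i) * t i} lastVanishes) ⟩
  ∑[ i < suc n ] (ℕ→ℚ (suc i) * t (suc i)) + ∑[ i < suc n ] (ℕ→ℚ (suc n ∸ i) * t i)
                                                                 ≡⟨ cong₂ _+_ (∑<-cong (suc n) (λ i → sym (*-assoc (ℕ→ℚ (suc i)) (f (suc i)) (g (n ∸ i)))))
                                                                              (∑<-congᵇ (suc n) moveWeight) ⟩
  ∑[ i < suc n ] (∂ f i * g (n ∸ i)) + ∑[ i < suc n ] (f i * ∂ g (n ∸ i))
                                                                 ≡⟨ cong₂ _+_ (⊛≡∑< (∂ f) g n) (⊛≡∑< f (∂ g) n) ⟨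
  (∂ f ⊛ g) n + (f ⊛ ∂ g) n                                      ∎
  where
  open ≡-Reasoning
  t : ℕ → ℚ
  t i = f i * g (suc n ∸ i)
  split : ∀ i → i < suc (suc n) → ℕ→ℚ (suc n) * t i ≡ ℕ→ℚ i * t i + ℕ→ℚ (suc n ∸ i) * t i
  split i (s≤s i≤1+n) = begin
    ℕ→ℚ (suc n) * t i                          ≡⟨ cong (λ m → ℕ→ℚ m * t i) (ℕₚ.m+[n∸m]≡n i≤1+n) ⟨
    ℕ→ℚ (i ℕ.+ (suc n ∸ i)) * t i              ≡⟨ cong (_* t i) (ℕ→ℚ-+ i (suc n ∸ i)) ⟩
    (ℕ→ℚ i + ℕ→ℚ (suc n ∸ i)) * t i            ≡⟨ *-distribʳ-+ (t i) (ℕ→ℚ i) _ ⟩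
    ℕ→ℚ i * t i + ℕ→ℚ (suc n ∸ i) * t i        ∎
  lastVanishes : ℕ→ℚ (suc n ∸ suc n) * t (suc n) ≡ 0ℚ
  lastVanishes = trans (cong (λ m → ℕ→ℚ m * t (suc n)) (ℕₚ.n∸n≡0 n)) (*-zeroˡ (t (suc n)))
  moveWeight : ∀ i → i < suc n → ℕ→ℚ (suc n ∸ i) * t i ≡ f i * ∂ g (n ∸ i)
  moveWeight i (s≤s i≤n) rewrite ℕₚ.+-∸-assoc 1 i≤n =
    solve 3 (λ c x y → c :* (x :* y) := x :* (c :* y)) refl (ℕ→ℚ (suc (n ∸ i))) (f i) (g (suc (n ∸ i)))

-- Powers of -log(1+x) and Stirling numbers of the first kind

[1+x]*∂-coeff : ∀ f n → ([1+x]* ∂ f) n ≡ ℕ→ℚ (suc n) * f (suc n) + ℕ→ℚ n * f n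
[1+x]*∂-coeff f zero    = sym (trans (cong (_+_ (ℕ→ℚ 1 * f 1)) (*-zeroˡ (f 0))) (+-identityʳ _))
[1+x]*∂-coeff f (suc n) = refl

∂-negLog1p : ∀ n → ∂ negLog1p n ≡ sgn (suc n)
∂-negLog1p n = begin
  ℕ→ℚ (suc n) * (sgn (suc n) * ((+ 1) / suc n))   ≡⟨ solve 3 (λ c s u → c :* (s :* u) := s :* (u :* c)) refl
                                                              (ℕ→ℚ (suc n)) (sgn (suc n)) ((+ 1) / suc n) ⟩
  sgn (suc n) * ((+ 1) / suc n * ℕ→ℚ (suc n))    ≡⟨ cong (sgn (suc n) *_) (1/suc-inverseˡ n) ⟩
  sgn (suc n) * 1ℚ                               ≡⟨ *-identityʳ (sgn (suc n)) ⟩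
  sgn (suc n)                                    ∎
  where open ≡-Reasoning

[1+x]*∂-negLog1p : ∀ n → ([1+x]* ∂ negLog1p) n ≡ - one n
[1+x]*∂-negLog1p zero    = ∂-negLog1p 0
[1+x]*∂-negLog1p (suc n) = trans (cong₂ _+_ (∂-negLog1p (suc n)) (∂-negLog1p n))
  (solve 1 (λ s → (:- con 1ℚ) :* ((:- con 1ℚ) :* s) :+ (:- con 1ℚ) :* s := con 0ℚ) refl (sgn n))

-- The Leibniz rule together with (1+x) · (-log(1+x))′ = -1.
[1+x]*∂-negLog1p-⊛ : ∀ g n → ([1+x]* ∂ (negLog1p ⊛ g)) n ≡ - g n + (negLog1p ⊛ ([1+x]* ∂ g)) n
[1+x]*∂-negLog1p-⊛ g n = begin
  ([1+x]* ∂ (L ⊛ g)) n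
    ≡⟨ [1+x]*-cong (∂-⊛ L g) n ⟩
  ([1+x]* (λ i → (∂ L ⊛ g) i + (L ⊛ ∂ g) i)) n
    ≡⟨ [1+x]*-+ (∂ L ⊛ g) (L ⊛ ∂ g) n ⟩
  ([1+x]* (∂ L ⊛ g)) n + ([1+x]* (L ⊛ ∂ g)) n
    ≡⟨ cong₂ _+_ ([1+x]*-⊛ˡ (∂ L) g n) ([1+x]*-⊛ʳ L (∂ g) n) ⟩
  (([1+x]* ∂ L) ⊛ g) n + (L ⊛ ([1+x]* ∂ g)) n
    ≡⟨ cong (_+ (L ⊛ ([1+x]* ∂ g)) n) (⊛-congˡ g [1+x]*∂-negLog1p n) ⟩
  ((λ i → - one i) ⊛ g) n + (L ⊛ ([1+x]* ∂ g)) n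
    ≡⟨ cong (_+ (L ⊛ ([1+x]* ∂ g)) n) (trans (⊛-negˡ one g n) (cong -_ (one-⊛ g n))) ⟩
  - g n + (L ⊛ ([1+x]* ∂ g)) n ∎
  where
  open ≡-Reasoning
  L = negLog1p

[1+x]*∂-negLog1p^suc : ∀ m n → ([1+x]* ∂ (negLog1p ^S suc m)) n ≡ - (ℕ→ℚ (suc m) * (negLog1p ^S m) n)
[1+x]*∂-negLog1p^suc zero n = begin
  ([1+x]* ∂ (negLog1p ⊛ one)) n                  ≡⟨ [1+x]*∂-negLog1p-⊛ one n ⟩
  - one n + (negLog1p ⊛ ([1+x]* ∂ one)) n        ≡⟨ cong (_+_ (- one n)) (⊛-zeroʳ negLog1p [1+x]*∂one≡0 n) ⟩
  - one n + 0ℚ                                   ≡⟨ solve 1 (λ x → :- x :+ con 0ℚ := :- (con 1ℚ :* x)) refl (one n) ⟩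
  - (1ℚ * one n)                                 ∎
  where
  open ≡-Reasoning
  ∂one≡0 : ∀ i → ∂ one i ≡ 0ℚ
  ∂one≡0 i = *-zeroʳ (ℕ→ℚ (suc i))
  [1+x]*∂one≡0 : ∀ i → ([1+x]* ∂ one) i ≡ 0ℚ
  [1+x]*∂one≡0 zero    = ∂one≡0 0
  [1+x]*∂one≡0 (suc i) = cong₂ _+_ (∂one≡0 (suc i)) (∂one≡0 i)
[1+x]*∂-negLog1p^suc (suc m) n = begin
  ([1+x]* ∂ (negLog1p ⊛ Q)) n                     ≡⟨ [1+x]*∂-negLog1p-⊛ Q n ⟩
  - Q n + (negLog1p ⊛ ([1+x]* ∂ Q)) n             ≡⟨ cong (_+_ (- Q n)) (⊛-congʳ negLog1p IH n) ⟩
  - Q n + (negLog1p ⊛ (λ i → - c * P i)) n        ≡⟨ cong (_+_ (- Q n)) (⊛-*ʳ (- c) negLog1p P n) ⟩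
  - Q n + - c * Q n                               ≡⟨ solve 2 (λ c q → :- q :+ (:- c) :* q := :- ((con 1ℚ :+ c) :* q)) refl c (Q n) ⟩
  - ((1ℚ + c) * Q n)                              ≡⟨ cong (λ x → - (x * Q n)) (ℕ→ℚ-suc (suc m)) ⟨
  - (ℕ→ℚ (suc (suc m)) * Q n)                     ∎
  where
  open ≡-Reasoning
  P Q : Series
  P = negLog1p ^S m
  Q = negLog1p ^S suc m
  c = ℕ→ℚ (suc m)
  IH : ∀ i → ([1+x]* ∂ Q) i ≡ - c * P i
  IH i = trans ([1+x]*∂-negLog1p^suc m i) (neg-distribˡ-* c (P i))

negLog1p^-coeff-rec : ∀ m n → ℕ→ℚ (suc n) * (negLog1p ^S suc m) (suc n)
  ≡ - (ℕ→ℚ (suc m) * (negLog1p ^S m) n) + - (ℕ→ℚ n * (negLog1p ^S suc m) n)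
negLog1p^-coeff-rec m n = begin
  ℕ→ℚ (suc n) * Q (suc n)                              ≡⟨ solve 2 (λ a b → a := (a :+ b) :+ :- b) refl _ (ℕ→ℚ n * Q n) ⟩
  (ℕ→ℚ (suc n) * Q (suc n) + ℕ→ℚ n * Q n) + - (ℕ→ℚ n * Q n)
                                                       ≡⟨ cong (_+ - (ℕ→ℚ n * Q n)) ([1+x]*∂-coeff Q n) ⟨
  ([1+x]* ∂ Q) n + - (ℕ→ℚ n * Q n)                     ≡⟨ cong (_+ - (ℕ→ℚ n * Q n)) ([1+x]*∂-negLog1p^suc m n) ⟩
  - (ℕ→ℚ (suc m) * (negLog1p ^S m) n) + - (ℕ→ℚ n * Q n) ∎
  where
  open ≡-Reasoning
  Q = negLog1p ^S suc m

stirling1-suc-zero : ∀ n → stirling1 (suc n) 0 ≡ 0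
stirling1-suc-zero zero    = refl
stirling1-suc-zero (suc n) = trans (cong (suc n ℕ.*_) (stirling1-suc-zero n)) (ℕₚ.*-zeroʳ (suc n))

stirling1-vanishes-above : ∀ {n m} → n < m → stirling1 n m ≡ 0
stirling1-vanishes-above {zero}  {suc m} _         = refl
stirling1-vanishes-above {suc n} {suc m} (s≤s n<m) =
  trans (cong₂ (λ a b → a ℕ.+ n ℕ.* b) (stirling1-vanishes-above n<m) (stirling1-vanishes-above (ℕₚ.m<n⇒m<1+n n<m)))
        (ℕₚ.*-zeroʳ n)

ℕ→ℚ-stirling1-suc : ∀ n m → ℕ→ℚ (stirling1 (suc n) (suc m)) ≡ ℕ→ℚ (stirling1 n m) + ℕ→ℚ n * ℕ→ℚ (stirling1 n (suc m))
ℕ→ℚ-stirling1-suc n m =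
  trans (ℕ→ℚ-+ (stirling1 n m) _) (cong (_+_ (ℕ→ℚ (stirling1 n m))) (ℕ→ℚ-* n (stirling1 n (suc m))))

-- Multiplying x(x+1)⋯(x+j-1) by x + j.
stirling1-∑-suc : ∀ j (y : ℕ → ℚ) →
  ∑[ m < suc (suc j) ] (ℕ→ℚ (stirling1 (suc j) m) * y m)
    ≡ ∑[ m < suc j ] (ℕ→ℚ (stirling1 j m) * y (suc m)) + ℕ→ℚ j * ∑[ m < suc j ] (ℕ→ℚ (stirling1 j m) * y m)
stirling1-∑-suc j y = begin
  ℕ→ℚ (stirling1 (suc j) 0) * y 0 + ∑[ m < suc j ] (ℕ→ℚ (stirling1 (suc j) (suc m)) * y (suc m))
    ≡⟨ cong₂ _+_ first (∑<-cong (suc j) split) ⟩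
  nj * z 0 + ∑[ m < suc j ] (ℕ→ℚ (stirling1 j m) * y (suc m) + nj * z (suc m))
    ≡⟨ cong (_+_ (nj * z 0)) (∑<-+ (suc j) (λ m → ℕ→ℚ (stirling1 j m) * y (suc m)) (λ m → nj * z (suc m))) ⟩
  nj * z 0 + (A + ∑[ m < suc j ] (nj * z (suc m)))
    ≡⟨ cong (λ x → nj * z 0 + (A + x)) (∑<-*ˡ (suc j) nj (z ∘ suc)) ⟩
  nj * z 0 + (A + nj * ∑< (suc j) (z ∘ suc))
    ≡⟨ solve 4 (λ n z a w → n :* z :+ (a :+ n :* w) := a :+ n :* (z :+ w)) refl nj (z 0) A (∑< (suc j) (z ∘ suc)) ⟩
  A + nj * ∑< (suc (suc j)) z
    ≡⟨ cong (λ x → A + nj * x) (∑<-dropLast (suc j) {z} lastVanishes) ⟩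
  A + nj * ∑< (suc j) z ∎
  where
  open ≡-Reasoning
  nj = ℕ→ℚ j
  z : ℕ → ℚ
  z m = ℕ→ℚ (stirling1 j m) * y m
  A = ∑[ m < suc j ] (ℕ→ℚ (stirling1 j m) * y (suc m))
  first : ℕ→ℚ (j ℕ.* stirling1 j 0) * y 0 ≡ nj * z 0
  first = trans (cong (_* y 0) (ℕ→ℚ-* j (stirling1 j 0))) (*-assoc nj _ (y 0))
  split : ∀ m → ℕ→ℚ (stirling1 (suc j) (suc m)) * y (suc m) ≡ ℕ→ℚ (stirling1 j m) * y (suc m) + nj * z (suc m)
  split m = trans (cong (_* y (suc m)) (ℕ→ℚ-stirling1-suc j m))
    (solve 4 (λ a n b y → (a :+ n :* b) :* y := a :* y :+ n :* (b :* y)) refl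
           (ℕ→ℚ (stirling1 j m)) nj (ℕ→ℚ (stirling1 j (suc m))) (y (suc m)))
  lastVanishes : z (suc j) ≡ 0ℚ
  lastVanishes = trans (cong (λ s → ℕ→ℚ s * y (suc j)) (stirling1-vanishes-above (ℕₚ.n<1+n j))) (*-zeroˡ (y (suc j)))

logPowCoeff : ℕ → ℕ → ℚ
logPowCoeff n m = factℚ n * invFact m * (negLog1p ^S m) n

logPowCoeff-suc : ∀ n m → logPowCoeff (suc n) (suc m) ≡ - (logPowCoeff n m + ℕ→ℚ n * logPowCoeff n (suc m))
logPowCoeff-suc n m = begin
  (N * F) * (u * I) * Q (suc n)                        ≡⟨ solve 5 (λ N F u I q → (N :* F) :* (u :* I) :* q := (F :* u :* I) :* (N :* q))
                                                                  refl N F u I (Q (suc n)) ⟩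
  (F * u * I) * (N * Q (suc n))                        ≡⟨ cong ((F * u * I) *_) (negLog1p^-coeff-rec m n) ⟩
  (F * u * I) * (- (c * P n) + - (nn * Q n))           ≡⟨ solve 7 (λ F u I c p nn q → (F :* u :* I) :* (:- (c :* p) :+ :- (nn :* q))
                                                                    := :- ((u :* c) :* (F :* I :* p) :+ nn :* (F :* (u :* I) :* q)))
                                                                  refl F u I c (P n) nn (Q n) ⟩
  - ((u * c) * logPowCoeff n m + nn * logPowCoeff n (suc m))
                                                       ≡⟨ cong (λ x → - (x * logPowCoeff n m + nn * logPowCoeff n (suc m))) (1/suc-inverseˡ m) ⟩
  - (1ℚ * logPowCoeff n m + nn * logPowCoeff n (suc m))
                                                       ≡⟨ cong (λ x → - (x + nn * logPowCoeff n (suc m))) (*-identityˡ (logPowCoeff n m)) ⟩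
  - (logPowCoeff n m + nn * logPowCoeff n (suc m))     ∎
  where
  open ≡-Reasoning
  N = ℕ→ℚ (suc n)
  F = factℚ n
  u = (+ 1) / suc m
  I = invFact m
  c = ℕ→ℚ (suc m)
  nn = ℕ→ℚ n
  P Q : Series
  P = negLog1p ^S m
  Q = negLog1p ^S suc m

logPowCoeff≡signedStirling1 : ∀ n m → logPowCoeff n m ≡ sgn n * ℕ→ℚ (stirling1 n m)
logPowCoeff≡signedStirling1 zero    zero    = refl
logPowCoeff≡signedStirling1 zero    (suc m) = trans (cong (1ℚ * invFact (suc m) *_) coeff₀)
                                                    (*-zeroʳ (1ℚ * invFact (suc m)))
  where
  coeff₀ : (negLog1p ^S suc m) 0 ≡ 0ℚ
  coeff₀ = trans (+-identityʳ (0ℚ * (negLog1p ^S m) 0)) (*-zeroˡ ((negLog1p ^S m) 0))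
logPowCoeff≡signedStirling1 (suc n) zero    = trans (*-zeroʳ (factℚ (suc n) * 1ℚ))
  (sym (trans (cong (λ s → sgn (suc n) * ℕ→ℚ s) (stirling1-suc-zero n)) (*-zeroʳ (sgn (suc n)))))
logPowCoeff≡signedStirling1 (suc n) (suc m) = begin
  logPowCoeff (suc n) (suc m)                                ≡⟨ logPowCoeff-suc n m ⟩
  - (logPowCoeff n m + nn * logPowCoeff n (suc m))            ≡⟨ cong₂ (λ x y → - (x + nn * y)) (logPowCoeff≡signedStirling1 n m)
                                                                                              (logPowCoeff≡signedStirling1 n (suc m)) ⟩
  - (s * ℕ→ℚ (stirling1 n m) + nn * (s * ℕ→ℚ (stirling1 n (suc m))))
                                                              ≡⟨ solve 4 (λ s a n b → :- (s :* a :+ n :* (s :* b)) := (:- con 1ℚ :* s) :* (a :+ n :* b))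
                                                                         refl s (ℕ→ℚ (stirling1 n m)) nn (ℕ→ℚ (stirling1 n (suc m))) ⟩
  sgn (suc n) * (ℕ→ℚ (stirling1 n m) + nn * ℕ→ℚ (stirling1 n (suc m)))
                                                              ≡⟨ cong (sgn (suc n) *_) (ℕ→ℚ-stirling1-suc n m) ⟨
  sgn (suc n) * ℕ→ℚ (stirling1 (suc n) (suc m))              ∎
  where
  open ≡-Reasoning
  s = sgn n
  nn = ℕ→ℚ n

stirling1Sum : (ℕ → ℚ) → ℕ → ℚ
stirling1Sum a j = sgn j * ∑[ m < suc j ] (ℕ→ℚ (stirling1 j m) * a m)

polyCauchy2≡stirling1Sum : ∀ k n → polyCauchy2 k n ≡ stirling1Sum (λ m → invPowSuc m k) n
polyCauchy2≡stirling1Sum k n = begin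
  factℚ n * Σ≤ n term                                        ≡⟨ cong (factℚ n *_) (Σ≤≡∑< n term) ⟩
  factℚ n * ∑< (suc n) term                                  ≡⟨ ∑<-*ˡ (suc n) (factℚ n) term ⟨
  ∑[ m < suc n ] (factℚ n * term m)                          ≡⟨ ∑<-cong (suc n) rearrange ⟩
  ∑[ m < suc n ] (sgn n * (ℕ→ℚ (stirling1 n m) * a m))       ≡⟨ ∑<-*ˡ (suc n) (sgn n) (λ m → ℕ→ℚ (stirling1 n m) * a m) ⟩
  stirling1Sum a n                                           ∎
  where
  open ≡-Reasoning
  a : ℕ → ℚ
  a m = invPowSuc m k
  term : ℕ → ℚ
  term m = invFact m * a m * (negLog1p ^S m) n
  rearrange : ∀ m → factℚ n * term m ≡ sgn n * (ℕ→ℚ (stirling1 n m) * a m)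
  rearrange m = begin
    factℚ n * term m                             ≡⟨ solve 4 (λ F I a p → F :* (I :* a :* p) := (F :* I :* p) :* a) refl
                                                            (factℚ n) (invFact m) (a m) ((negLog1p ^S m) n) ⟩
    logPowCoeff n m * a m                        ≡⟨ cong (_* a m) (logPowCoeff≡signedStirling1 n m) ⟩
    sgn n * ℕ→ℚ (stirling1 n m) * a m            ≡⟨ *-assoc (sgn n) _ (a m) ⟩
    sgn n * (ℕ→ℚ (stirling1 n m) * a m)          ∎

-- Difference operators

∇ : (ℕ → ℚ) → ℕ → ℚ
∇ a m = a m + - a (suc m)

Θ : (ℕ → ℚ) → ℕ → ℚ
Θ b j = ℕ→ℚ (suc j) * b j + b (suc j)

Θ-cong : ∀ {b b′} → (∀ j → b j ≡ b′ j) → ∀ j → Θ b j ≡ Θ b′ j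
Θ-cong b≡b′ j = cong₂ _+_ (cong (ℕ→ℚ (suc j) *_) (b≡b′ j)) (b≡b′ (suc j))

Θ^-cong : ∀ p {b b′} → (∀ j → b j ≡ b′ j) → ∀ j → (Θ ^ p) b j ≡ (Θ ^ p) b′ j
Θ^-cong zero    b≡b′ = b≡b′
Θ^-cong (suc p) b≡b′ = Θ-cong (Θ^-cong p b≡b′)

^-sucʳ : ∀ f p (a : ℕ → ℚ) → (f ^ p) (f a) ≡ (f ^ suc p) a
^-sucʳ f zero    a = refl
^-sucʳ f (suc p) a = cong f (^-sucʳ f p a)

stirling1Sum-suc : ∀ a j → stirling1Sum a (suc j) ≡ stirling1Sum (∇ a) j + - (ℕ→ℚ (suc j) * stirling1Sum a j)
stirling1Sum-suc a j = begin
  sgn (suc j) * ∑[ m < suc (suc j) ] (ℕ→ℚ (stirling1 (suc j) m) * a m)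
    ≡⟨ cong (sgn (suc j) *_) (stirling1-∑-suc j a) ⟩
  (- 1ℚ * s) * (A + nj * W)
    ≡⟨ solve 4 (λ s a n w → (:- con 1ℚ :* s) :* (a :+ n :* w) := s :* (w :+ :- a) :+ :- ((con 1ℚ :+ n) :* (s :* w)))
               refl s A nj W ⟩
  s * (W + - A) + - ((1ℚ + nj) * (s * W))
    ≡⟨ cong₂ (λ x y → s * x + - (y * (s * W))) (∑<-*-− (suc j) (λ m → ℕ→ℚ (stirling1 j m)) a (a ∘ suc)) (ℕ→ℚ-suc j) ⟨
  stirling1Sum (∇ a) j + - (ℕ→ℚ (suc j) * stirling1Sum a j) ∎
  where
  open ≡-Reasoning
  s = sgn j
  nj = ℕ→ℚ j
  W = ∑[ m < suc j ] (ℕ→ℚ (stirling1 j m) * a m)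
  A = ∑[ m < suc j ] (ℕ→ℚ (stirling1 j m) * a (suc m))

stirling1Sum-Θ : ∀ a j → Θ (stirling1Sum a) j ≡ stirling1Sum (∇ a) j
stirling1Sum-Θ a j = begin
  c * stirling1Sum a j + stirling1Sum a (suc j)                         ≡⟨ cong (_+_ (c * stirling1Sum a j)) (stirling1Sum-suc a j) ⟩
  c * stirling1Sum a j + (stirling1Sum (∇ a) j + - (c * stirling1Sum a j)) ≡⟨ solve 2 (λ x y → x :+ (y :+ :- x) := y) refl
                                                                                 (c * stirling1Sum a j) (stirling1Sum (∇ a) j) ⟩
  stirling1Sum (∇ a) j                                                  ∎
  where
  open ≡-Reasoning
  c = ℕ→ℚ (suc j)

Θ^-stirling1Sum : ∀ p a j → (Θ ^ p) (stirling1Sum a) j ≡ stirling1Sum ((∇ ^ p) a) j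
Θ^-stirling1Sum zero    a j = refl
Θ^-stirling1Sum (suc p) a j = trans (Θ-cong (Θ^-stirling1Sum p a) j) (stirling1Sum-Θ ((∇ ^ p) a) j)

-- sgn (r ∸ ℓ) * [r+1, ℓ+1] is the coefficient of t^ℓ in (t-1)(t-2)⋯(t-r).
signedStirling1Sum : ℕ → (ℕ → ℚ) → ℚ
signedStirling1Sum r z = ∑[ ℓ < suc r ] (sgn (r ∸ ℓ) * ℕ→ℚ (stirling1 (suc r) (suc ℓ)) * z ℓ)

signedStirling1Sum-suc : ∀ r z →
  signedStirling1Sum (suc r) z ≡ signedStirling1Sum r (z ∘ suc) + - (ℕ→ℚ (suc r) * signedStirling1Sum r z)
signedStirling1Sum-suc r z = begin
  ∑[ ℓ < suc (suc r) ] (sgn (suc r ∸ ℓ) * ℕ→ℚ (stirling1 (suc (suc r)) (suc ℓ)) * z ℓ)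
    ≡⟨ ∑<-cong (suc (suc r)) split ⟩
  ∑[ ℓ < suc (suc r) ] (u ℓ + v ℓ)
    ≡⟨ ∑<-+ (suc (suc r)) u v ⟩
  ∑< (suc (suc r)) u + ∑< (suc (suc r)) v
    ≡⟨ cong₂ _+_ (∑<-dropFirst (suc r) {u} u₀≡0) (∑<-dropLast (suc r) {v} vLast≡0) ⟩
  signedStirling1Sum r (z ∘ suc) + ∑< (suc r) v
    ≡⟨ cong (_+_ (signedStirling1Sum r (z ∘ suc))) (∑<-congᵇ (suc r) v≡-N*w) ⟩
  signedStirling1Sum r (z ∘ suc) + ∑[ ℓ < suc r ] (- (N * w ℓ))
    ≡⟨ cong (_+_ (signedStirling1Sum r (z ∘ suc))) (trans (∑<-neg (suc r) (λ ℓ → N * w ℓ)) (cong -_ (∑<-*ˡ (suc r) N w))) ⟩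
  signedStirling1Sum r (z ∘ suc) + - (N * signedStirling1Sum r z) ∎
  where
  open ≡-Reasoning
  N = ℕ→ℚ (suc r)
  u v w : ℕ → ℚ
  u ℓ = sgn (suc r ∸ ℓ) * ℕ→ℚ (stirling1 (suc r) ℓ) * z ℓ
  v ℓ = sgn (suc r ∸ ℓ) * (N * ℕ→ℚ (stirling1 (suc r) (suc ℓ))) * z ℓ
  w ℓ = sgn (r ∸ ℓ) * ℕ→ℚ (stirling1 (suc r) (suc ℓ)) * z ℓ
  split : ∀ ℓ → sgn (suc r ∸ ℓ) * ℕ→ℚ (stirling1 (suc (suc r)) (suc ℓ)) * z ℓ ≡ u ℓ + v ℓ
  split ℓ = trans (cong (λ x → sgn (suc r ∸ ℓ) * x * z ℓ) (ℕ→ℚ-stirling1-suc (suc r) ℓ))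
    (solve 4 (λ g x y t → g :* (x :+ y) :* t := g :* x :* t :+ g :* y :* t) refl
           (sgn (suc r ∸ ℓ)) (ℕ→ℚ (stirling1 (suc r) ℓ)) (N * ℕ→ℚ (stirling1 (suc r) (suc ℓ))) (z ℓ))
  u₀≡0 : u 0 ≡ 0ℚ
  u₀≡0 = trans (cong (λ s → sgn (suc r) * ℕ→ℚ s * z 0) (stirling1-suc-zero r))
               (trans (cong (_* z 0) (*-zeroʳ (sgn (suc r)))) (*-zeroˡ (z 0)))
  vLast≡0 : v (suc r) ≡ 0ℚ
  vLast≡0 = trans (cong (λ s → sgn (r ∸ r) * (N * ℕ→ℚ s) * z (suc r)) (stirling1-vanishes-above (ℕₚ.n<1+n (suc r))))
                  (trans (cong (λ x → sgn (r ∸ r) * x * z (suc r)) (*-zeroʳ N))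
                         (trans (cong (_* z (suc r)) (*-zeroʳ (sgn (r ∸ r)))) (*-zeroˡ (z (suc r)))))
  v≡-N*w : ∀ ℓ → ℓ < suc r → v ℓ ≡ - (N * w ℓ)
  v≡-N*w ℓ (s≤s ℓ≤r) rewrite ℕₚ.+-∸-assoc 1 ℓ≤r =
    solve 4 (λ g c x t → (:- con 1ℚ :* g) :* (c :* x) :* t := :- (c :* (g :* x :* t))) refl
          (sgn (r ∸ ℓ)) N (ℕ→ℚ (stirling1 (suc r) (suc ℓ))) (z ℓ)

-- Both sides satisfy u (r+1) y = u r (∇ y) - (r+1) · u r y, by stirling1Sum-suc and
-- signedStirling1Sum-suc.
stirling1Sum≡signedStirling1Sum-∇ : ∀ r y → stirling1Sum y r ≡ signedStirling1Sum r (λ ℓ → (∇ ^ ℓ) y 0)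
stirling1Sum≡signedStirling1Sum-∇ zero    y =
  solve 1 (λ t → con 1ℚ :* (con 1ℚ :* t :+ con 0ℚ) := con 1ℚ :* con 1ℚ :* t :+ con 0ℚ) refl (y 0)
stirling1Sum≡signedStirling1Sum-∇ (suc r) y = begin
  stirling1Sum y (suc r)
    ≡⟨ stirling1Sum-suc y r ⟩
  stirling1Sum (∇ y) r + - (N * stirling1Sum y r)
    ≡⟨ cong₂ (λ x x′ → x + - (N * x′)) (stirling1Sum≡signedStirling1Sum-∇ r (∇ y)) (stirling1Sum≡signedStirling1Sum-∇ r y) ⟩
  signedStirling1Sum r (λ ℓ → (∇ ^ ℓ) (∇ y) 0) + - (N * signedStirling1Sum r (λ ℓ → (∇ ^ ℓ) y 0))
    ≡⟨ cong (_+ - (N * signedStirling1Sum r (λ ℓ → (∇ ^ ℓ) y 0)))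
            (∑<-cong (suc r) (λ ℓ → cong (λ d → sgn (r ∸ ℓ) * ℕ→ℚ (stirling1 (suc r) (suc ℓ)) * d 0) (^-sucʳ ∇ ℓ y))) ⟩
  signedStirling1Sum r (λ ℓ → (∇ ^ suc ℓ) y 0) + - (N * signedStirling1Sum r (λ ℓ → (∇ ^ ℓ) y 0))
    ≡⟨ signedStirling1Sum-suc r (λ ℓ → (∇ ^ ℓ) y 0) ⟨
  signedStirling1Sum (suc r) (λ ℓ → (∇ ^ ℓ) y 0) ∎
  where
  open ≡-Reasoning
  N = ℕ→ℚ (suc r)

alternatingBinomial : ℕ → (ℕ → ℚ) → ℚ
alternatingBinomial p x = ∑[ i < suc p ] (ℕ→ℚ (choose p i) * sgn i * x i)

alternatingBinomial-cong : ∀ p {x y} → (∀ i → x i ≡ y i) → alternatingBinomial p x ≡ alternatingBinomial p y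
alternatingBinomial-cong p x≡y = ∑<-cong (suc p) (λ i → cong (ℕ→ℚ (choose p i) * sgn i *_) (x≡y i))

choose-vanishes-above : ∀ {n m} → n < m → choose n m ≡ 0
choose-vanishes-above {zero}  {suc m} _         = refl
choose-vanishes-above {suc n} {suc m} (s≤s n<m) =
  cong₂ ℕ._+_ (choose-vanishes-above n<m) (choose-vanishes-above (ℕₚ.m<n⇒m<1+n n<m))

-- Pascal's rule.
alternatingBinomial-suc : ∀ p x →
  alternatingBinomial (suc p) x ≡ alternatingBinomial p x + - alternatingBinomial p (x ∘ suc)
alternatingBinomial-suc p x = begin
  t₀ + ∑[ i < suc p ] (ℕ→ℚ (choose p i ℕ.+ choose p (suc i)) * sgn (suc i) * x (suc i))
    ≡⟨ cong (_+_ t₀) (∑<-cong (suc p) split) ⟩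
  t₀ + ∑[ i < suc p ] (- (ℕ→ℚ (choose p i) * sgn i * x (suc i)) + t (suc i))
    ≡⟨ cong (_+_ t₀) (∑<-+ (suc p) (λ i → - (ℕ→ℚ (choose p i) * sgn i * x (suc i))) (t ∘ suc)) ⟩
  t₀ + (∑[ i < suc p ] (- (ℕ→ℚ (choose p i) * sgn i * x (suc i))) + ∑< (suc p) (t ∘ suc))
    ≡⟨ cong₂ (λ a b → t₀ + (a + b)) (∑<-neg (suc p) (λ i → ℕ→ℚ (choose p i) * sgn i * x (suc i)))
                                    (∑<-dropLast p {t ∘ suc} tLast≡0) ⟩
  t₀ + (- alternatingBinomial p (x ∘ suc) + ∑< p (t ∘ suc))
    ≡⟨ solve 3 (λ a b c → a :+ (b :+ c) := (a :+ c) :+ b) refl t₀ (- alternatingBinomial p (x ∘ suc)) (∑< p (t ∘ suc)) ⟩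
  alternatingBinomial p x + - alternatingBinomial p (x ∘ suc) ∎
  where
  open ≡-Reasoning
  t₀ = ℕ→ℚ 1 * sgn 0 * x 0
  t : ℕ → ℚ
  t i = ℕ→ℚ (choose p i) * sgn i * x i
  split : ∀ i → ℕ→ℚ (choose p i ℕ.+ choose p (suc i)) * sgn (suc i) * x (suc i)
              ≡ - (ℕ→ℚ (choose p i) * sgn i * x (suc i)) + t (suc i)
  split i = trans (cong (λ c → c * sgn (suc i) * x (suc i)) (ℕ→ℚ-+ (choose p i) (choose p (suc i))))
    (solve 4 (λ a b s y → (a :+ b) :* (:- con 1ℚ :* s) :* y := :- (a :* s :* y) :+ b :* (:- con 1ℚ :* s) :* y) refl
           (ℕ→ℚ (choose p i)) (ℕ→ℚ (choose p (suc i))) (sgn i) (x (suc i)))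
  tLast≡0 : t (suc p) ≡ 0ℚ
  tLast≡0 = trans (cong (λ c → ℕ→ℚ c * sgn (suc p) * x (suc p)) (choose-vanishes-above (ℕₚ.n<1+n p)))
                  (trans (cong (_* x (suc p)) (*-zeroˡ (sgn (suc p)))) (*-zeroˡ (x (suc p))))

∇^≡alternatingBinomial : ∀ p a m → (∇ ^ p) a m ≡ alternatingBinomial p (λ i → a (m ℕ.+ i))
∇^≡alternatingBinomial zero    a m =
  trans (cong a (sym (ℕₚ.+-identityʳ m))) (solve 1 (λ t → t := con 1ℚ :* con 1ℚ :* t :+ con 0ℚ) refl (a (m ℕ.+ 0)))
∇^≡alternatingBinomial (suc p) a m = begin
  (∇ ^ p) a m + - (∇ ^ p) a (suc m)
    ≡⟨ cong₂ (λ x y → x + - y) (∇^≡alternatingBinomial p a m) (∇^≡alternatingBinomial p a (suc m)) ⟩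
  alternatingBinomial p (λ i → a (m ℕ.+ i)) + - alternatingBinomial p (λ i → a (suc m ℕ.+ i))
    ≡⟨ cong (λ x → alternatingBinomial p (λ i → a (m ℕ.+ i)) + - x)
            (alternatingBinomial-cong p (λ i → cong a (sym (ℕₚ.+-suc m i)))) ⟩
  alternatingBinomial p (λ i → a (m ℕ.+ i)) + - alternatingBinomial p (λ i → a (m ℕ.+ suc i))
    ≡⟨ alternatingBinomial-suc p (λ i → a (m ℕ.+ i)) ⟨
  alternatingBinomial (suc p) (λ i → a (m ℕ.+ i)) ∎
  where open ≡-Reasoning

signedStirling1Sum-∇^≡Σ[1⋯] : ∀ r p a →
  signedStirling1Sum r (λ ℓ → (∇ ^ ℓ) ((∇ ^ p) a) 0)
    ≡ Σ[ 1 ⋯ suc r ] (λ ℓ → sgn (suc r ∸ ℓ) * ℕ→ℚ (stirling1 (suc r) ℓ)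
        * Σ≤ (p ℕ.+ r ℕ.+ ℓ ∸ suc r) (λ i → ℕ→ℚ (choose (p ℕ.+ r ℕ.+ ℓ ∸ suc r) i) * sgn i * a i))
signedStirling1Sum-∇^≡Σ[1⋯] r p a = begin
  signedStirling1Sum r (λ ℓ → (∇ ^ ℓ) ((∇ ^ p) a) 0)
    ≡⟨ ∑<-cong (suc r) (λ ℓ → cong (sgn (r ∸ ℓ) * ℕ→ℚ (stirling1 (suc r) (suc ℓ)) *_) (differences ℓ)) ⟩
  ∑[ ℓ < suc r ] g (suc ℓ)
    ≡⟨ Σ[⋯]≡∑< 1 (suc r) g ⟨
  Σ[ 1 ⋯ suc r ] g ∎
  where
  open ≡-Reasoning
  q : ℕ → ℕ
  q ℓ = p ℕ.+ r ℕ.+ ℓ ∸ suc r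
  g : ℕ → ℚ
  g ℓ = sgn (suc r ∸ ℓ) * ℕ→ℚ (stirling1 (suc r) ℓ) * Σ≤ (q ℓ) (λ i → ℕ→ℚ (choose (q ℓ) i) * sgn i * a i)
  degree : ∀ ℓ → ℓ ℕ.+ p ≡ q (suc ℓ)
  degree ℓ = begin
    ℓ ℕ.+ p                        ≡⟨ ℕₚ.m+n∸n≡m (ℓ ℕ.+ p) r ⟨
    ℓ ℕ.+ p ℕ.+ r ∸ r              ≡⟨ cong (_∸ r) (trans (ℕₚ.+-assoc ℓ p r) (ℕₚ.+-comm ℓ (p ℕ.+ r))) ⟩
    suc (p ℕ.+ r ℕ.+ ℓ) ∸ suc r    ≡⟨ cong (_∸ suc r) (ℕₚ.+-suc (p ℕ.+ r) ℓ) ⟨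
    q (suc ℓ)                      ∎
  differences : ∀ ℓ → (∇ ^ ℓ) ((∇ ^ p) a) 0 ≡ Σ≤ (q (suc ℓ)) (λ i → ℕ→ℚ (choose (q (suc ℓ)) i) * sgn i * a i)
  differences ℓ = begin
    (∇ ^ ℓ) ((∇ ^ p) a) 0               ≡⟨ cong (λ f → f a 0) (^-homo ∇ ℓ p) ⟨
    (∇ ^ (ℓ ℕ.+ p)) a 0                 ≡⟨ ∇^≡alternatingBinomial (ℓ ℕ.+ p) a 0 ⟩
    alternatingBinomial (ℓ ℕ.+ p) a     ≡⟨ cong (λ d → alternatingBinomial d a) (degree ℓ) ⟩
    alternatingBinomial (q (suc ℓ)) a   ≡⟨ Σ≤≡∑< (q (suc ℓ)) (λ i → ℕ→ℚ (choose (q (suc ℓ)) i) * sgn i * a i) ⟨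
    Σ≤ (q (suc ℓ)) (λ i → ℕ→ℚ (choose (q (suc ℓ)) i) * sgn i * a i) ∎

-- r-Stirling numbers of the second kind

<ᵇ-false : ∀ {m n} → n ≤ m → (m ℕ.<ᵇ n) ≡ false
<ᵇ-false {m} {n} n≤m = dec-false (m <? n) (ℕₚ.≤⇒≯ n≤m)

≡ᵇ-false : ∀ {m n} → m ≢ n → (m ℕ.≡ᵇ n) ≡ false
≡ᵇ-false {m} {n} = dec-false (m ≟ n)

≡ᵇ-true⇒≡ : ∀ {m n} → (m ℕ.≡ᵇ n) ≡ true → m ≡ n
≡ᵇ-true⇒≡ {m} {n} m≡ᵇn = ℕₚ.≡ᵇ⇒≡ m n (subst T (sym m≡ᵇn) tt)

≡ᵇ-refl : ∀ n → (n ℕ.≡ᵇ n) ≡ true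
≡ᵇ-refl n = dec-true (n ≟ n) refl

rStirling2-suc : ∀ {r N} m → r ≤ N →
  rStirling2 r (suc N) (suc m) ≡ suc m ℕ.* rStirling2 r N (suc m) ℕ.+ rStirling2 r N m
rStirling2-suc {r} {N} m r≤N
  rewrite <ᵇ-false {suc N} {r} (ℕₚ.m≤n⇒m≤1+n r≤N) | ≡ᵇ-false {suc N} {r} (ℕₚ.>⇒≢ (s≤s r≤N)) = refl

rStirling2-diag : ∀ r → rStirling2 r r r ≡ 1
rStirling2-diag zero    = refl
rStirling2-diag (suc r) rewrite <ᵇ-false {r} {r} ℕₚ.≤-refl | ≡ᵇ-refl r = refl

rStirling2-vanishes-below : ∀ {r} N {m} → m < r → rStirling2 r N m ≡ 0
rStirling2-vanishes-below {suc r} zero    _   = refl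
rStirling2-vanishes-below {r} (suc N) {m} m<r with suc N ℕ.<ᵇ r | suc N ℕ.≡ᵇ r
... | true  | _     = refl
... | false | true  rewrite ≡ᵇ-false (ℕₚ.<⇒≢ m<r) = refl
... | false | false with m
...   | zero  = refl
...   | suc m rewrite rStirling2-vanishes-below {r} N m<r | rStirling2-vanishes-below {r} N (ℕₚ.<-trans (ℕₚ.n<1+n m) m<r) =
  trans (ℕₚ.+-identityʳ (m ℕ.* 0)) (ℕₚ.*-zeroʳ m)

rStirling2-vanishes-above : ∀ {r} N {m} → N < m → rStirling2 r N m ≡ 0
rStirling2-vanishes-above {zero}  zero {suc m} _ = refl
rStirling2-vanishes-above {suc r} zero {suc m} _ = refl
rStirling2-vanishes-above {r} (suc N) {suc m} (s≤s N<m) with suc N ℕ.<ᵇ r | suc N ℕ.≡ᵇ r in 1+N≡ᵇr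
... | true  | _     = refl
... | false | true
  rewrite ≡ᵇ-false {suc m} {r} (λ 1+m≡r → ℕₚ.<-irrefl (trans (≡ᵇ-true⇒≡ 1+N≡ᵇr) (sym 1+m≡r)) (s≤s N<m)) = refl
... | false | false
  rewrite rStirling2-vanishes-above {r} N N<m | rStirling2-vanishes-above {r} N (ℕₚ.m<n⇒m<1+n N<m) =
  trans (ℕₚ.+-identityʳ (m ℕ.* 0)) (ℕₚ.*-zeroʳ m)

rStirling2-∑-suc : ∀ r N b → r < N →
  ∑[ j < suc N ] (ℕ→ℚ (rStirling2 (suc r) (suc N) (suc j)) * b j)
    ≡ ∑[ j < N ] (ℕ→ℚ (rStirling2 (suc r) N (suc j)) * Θ b j)
rStirling2-∑-suc r N b r<N = begin
  ∑[ j < suc N ] (ℕ→ℚ (S (suc N) (suc j)) * b j)   ≡⟨ ∑<-cong (suc N) split ⟩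
  ∑[ j < suc N ] (x j + y j)                        ≡⟨ ∑<-+ (suc N) x y ⟩
  ∑< (suc N) x + ∑< (suc N) y                       ≡⟨ cong₂ _+_ (∑<-dropLast N {x} xLast≡0) (∑<-dropFirst N {y} y₀≡0) ⟩
  ∑< N x + ∑< N (y ∘ suc)                           ≡⟨ ∑<-+ N x (y ∘ suc) ⟨
  ∑[ j < N ] (x j + y (suc j))                      ≡⟨ ∑<-cong N factor ⟩
  ∑[ j < N ] (ℕ→ℚ (S N (suc j)) * Θ b j)           ∎
  where
  open ≡-Reasoning
  S : ℕ → ℕ → ℕ
  S = rStirling2 (suc r)
  x y : ℕ → ℚ
  x j = ℕ→ℚ (suc j) * ℕ→ℚ (S N (suc j)) * b j
  y j = ℕ→ℚ (S N j) * b j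
  split : ∀ j → ℕ→ℚ (S (suc N) (suc j)) * b j ≡ x j + y j
  split j = begin
    ℕ→ℚ (S (suc N) (suc j)) * b j                                    ≡⟨ cong (λ s → ℕ→ℚ s * b j) (rStirling2-suc j r<N) ⟩
    ℕ→ℚ (suc j ℕ.* S N (suc j) ℕ.+ S N j) * b j                      ≡⟨ cong (_* b j) (ℕ→ℚ-+ (suc j ℕ.* S N (suc j)) (S N j)) ⟩
    (ℕ→ℚ (suc j ℕ.* S N (suc j)) + ℕ→ℚ (S N j)) * b j                ≡⟨ cong (λ s → (s + ℕ→ℚ (S N j)) * b j) (ℕ→ℚ-* (suc j) (S N (suc j))) ⟩
    (ℕ→ℚ (suc j) * ℕ→ℚ (S N (suc j)) + ℕ→ℚ (S N j)) * b j            ≡⟨ *-distribʳ-+ (b j) (ℕ→ℚ (suc j) * ℕ→ℚ (S N (suc j))) (ℕ→ℚ (S N j)) ⟩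
    x j + y j                                                        ∎
  xLast≡0 : x N ≡ 0ℚ
  xLast≡0 = trans (cong (λ s → ℕ→ℚ (suc N) * ℕ→ℚ s * b N) (rStirling2-vanishes-above N (ℕₚ.n<1+n N)))
                  (trans (cong (_* b N) (*-zeroʳ (ℕ→ℚ (suc N)))) (*-zeroˡ (b N)))
  y₀≡0 : y 0 ≡ 0ℚ
  y₀≡0 = trans (cong (λ s → ℕ→ℚ s * b 0) (rStirling2-vanishes-below N (s≤s z≤n))) (*-zeroˡ (b 0))
  factor : ∀ j → x j + y (suc j) ≡ ℕ→ℚ (S N (suc j)) * Θ b j
  factor j = solve 4 (λ c s u v → c :* s :* u :+ s :* v := s :* (c :* u :+ v)) refl
                   (ℕ→ℚ (suc j)) (ℕ→ℚ (S N (suc j))) (b j) (b (suc j))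

rStirling2-∑≡Θ^ : ∀ r p b →
  ∑[ j < suc (p ℕ.+ r) ] (ℕ→ℚ (rStirling2 (suc r) (suc (p ℕ.+ r)) (suc j)) * b j) ≡ (Θ ^ p) b r
rStirling2-∑≡Θ^ r zero b = begin
  ∑[ j < suc r ] (ℕ→ℚ (rStirling2 (suc r) (suc r) (suc j)) * b j)
    ≡⟨ ∑<-sucʳ r (λ j → ℕ→ℚ (rStirling2 (suc r) (suc r) (suc j)) * b j) ⟩
  ∑[ j < r ] (ℕ→ℚ (rStirling2 (suc r) (suc r) (suc j)) * b j) + ℕ→ℚ (rStirling2 (suc r) (suc r) (suc r)) * b r
    ≡⟨ cong₂ _+_ (∑<-zero r below) (cong (λ s → ℕ→ℚ s * b r) (rStirling2-diag (suc r))) ⟩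
  0ℚ + 1ℚ * b r
    ≡⟨ trans (+-identityˡ (1ℚ * b r)) (*-identityˡ (b r)) ⟩
  b r ∎
  where
  open ≡-Reasoning
  below : ∀ j → j < r → ℕ→ℚ (rStirling2 (suc r) (suc r) (suc j)) * b j ≡ 0ℚ
  below j j<r = trans (cong (λ s → ℕ→ℚ s * b j) (rStirling2-vanishes-below (suc r) (s≤s j<r))) (*-zeroˡ (b j))
rStirling2-∑≡Θ^ r (suc p) b = begin
  ∑[ j < suc (suc p ℕ.+ r) ] (ℕ→ℚ (rStirling2 (suc r) (suc (suc p ℕ.+ r)) (suc j)) * b j)
    ≡⟨ rStirling2-∑-suc r (suc (p ℕ.+ r)) b (s≤s (ℕₚ.m≤n+m r p)) ⟩
  ∑[ j < suc (p ℕ.+ r) ] (ℕ→ℚ (rStirling2 (suc r) (suc (p ℕ.+ r)) (suc j)) * Θ b j)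
    ≡⟨ rStirling2-∑≡Θ^ r p (Θ b) ⟩
  (Θ ^ p) (Θ b) r
    ≡⟨ cong-app (^-sucʳ Θ p b) r ⟩
  (Θ ^ suc p) b r ∎
  where open ≡-Reasoning

Σ[⋯]-rStirling2≡Θ^ : ∀ r p b →
  Σ[ r ⋯ p ℕ.+ r ] (λ j → ℕ→ℚ (rStirling2 (suc r) (suc (p ℕ.+ r)) (suc j)) * b j) ≡ (Θ ^ p) b r
Σ[⋯]-rStirling2≡Θ^ r p b =
  trans (Σ[⋯]≡∑<-vanishing-below r (p ℕ.+ r) (ℕₚ.m≤n⇒m≤1+n (ℕₚ.m≤n+m r p)) below) (rStirling2-∑≡Θ^ r p b)
  where
  below : ∀ j → j < r → ℕ→ℚ (rStirling2 (suc r) (suc (p ℕ.+ r)) (suc j)) * b j ≡ 0ℚ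
  below j j<r = trans (cong (λ s → ℕ→ℚ s * b j) (rStirling2-vanishes-below (suc (p ℕ.+ r)) (s≤s j<r))) (*-zeroˡ (b j))

theorem4 : (n r : ℕ) (k : ℤ) → 1 ≤ r → r ∸ 1 ≤ n →
    Σ[ r ∸ 1 ⋯ n ] (λ j → ℕ→ℚ (rStirling2 r (suc n) (suc j)) * polyCauchy2 k j)
    ≡ Σ[ 1 ⋯ r ] (λ ℓ → sgn (r ∸ ℓ) * ℕ→ℚ (stirling1 r ℓ)
    * Σ≤ (n ℕ.+ ℓ ∸ r) (λ i → ℕ→ℚ (choose (n ℕ.+ ℓ ∸ r) i) * sgn i * invPowSuc i k))
theorem4 n (suc r) k _ r≤n with n ∸ r | ℕₚ.m∸n+n≡m r≤n
... | p | refl = begin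
  Σ[ r ⋯ p ℕ.+ r ] (λ j → ℕ→ℚ (rStirling2 (suc r) (suc (p ℕ.+ r)) (suc j)) * polyCauchy2 k j)
    ≡⟨ Σ[⋯]-rStirling2≡Θ^ r p (polyCauchy2 k) ⟩
  (Θ ^ p) (polyCauchy2 k) r
    ≡⟨ Θ^-cong p (polyCauchy2≡stirling1Sum k) r ⟩
  (Θ ^ p) (stirling1Sum a) r
    ≡⟨ Θ^-stirling1Sum p a r ⟩
  stirling1Sum ((∇ ^ p) a) r
    ≡⟨ stirling1Sum≡signedStirling1Sum-∇ r ((∇ ^ p) a) ⟩
  signedStirling1Sum r (λ ℓ → (∇ ^ ℓ) ((∇ ^ p) a) 0)
    ≡⟨ signedStirling1Sum-∇^≡Σ[1⋯] r p a ⟩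
  Σ[ 1 ⋯ suc r ] (λ ℓ → sgn (suc r ∸ ℓ) * ℕ→ℚ (stirling1 (suc r) ℓ)
    * Σ≤ (p ℕ.+ r ℕ.+ ℓ ∸ suc r) (λ i → ℕ→ℚ (choose (p ℕ.+ r ℕ.+ ℓ ∸ suc r) i) * sgn i * a i)) ∎
  where
  open ≡-Reasoning
  a : ℕ → ℚ
  a i = invPowSuc i k
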